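{- Let $k>1$, $1\le j\le k-1$, and $\gamma=\Lambda_j^\vee$. Then $z_\gamma=(w_jw_k^{ -1}w_{k+1})^j$.
   Context: $W$ is the affine Weyl group of type $C_k^{(1)}$, generated by $s_0,\dots,s_k$ with relations $s_i^2=1$; $s_is_j=s_js_i$ if $|i-j|\ne1$; $s_is_{i+1}s_i=s_{i+1}s_is_{i+1}$ for $1\le i\le k-2$; $(s_is_{i+1})^2=(s_{i+1}s_i)^2$ for $i\in\{0,k-1\}$. It acts faithfully on $V=\mathbb{R}^k$ by affine maps: $s_i$ swaps $a_i,a_{i+1}$ ($1\le i\le k-1$), $s_k$ negates $a_k$, $s_0\diamond(a_1,\dots,a_k)=(2-a_1,a_2,\dots,a_k)$, with $(uv)\diamond x=u\diamond(v\diamond x)$. For $1\le i\le k+1$, $w_i:=s_{i-1}\cdots s_1s_0$. Let $\epsilon_1,\dots,\epsilon_k$ be the standard basis; the fundamental coweights are $\Lambda_i^\vee=2(\epsilon_1+\dots+\epsilon_i)$ for $1\le i<k$ and $\Lambda_k^\vee=\epsilon_1+\dots+\epsilon_k$, spanning the coweight lattice $P^\vee$. For $\gamma\in P^\vee$, $t_\gamma$ is translation $\mu\mapsto\mu+\gamma$. $W_{\mathrm{ext}}$ is the group of affine maps of $V$ generated by $W$ and all $t_\gamma$. The fundamental alcove is $\mathcal{A}_\emptyset=\{1\ge a_1\ge a_2\ge\dots\ge a_k\ge0\}$ and $\Omega$ its stabilizer in $W_{\mathrm{ext}}$; every $t\in W_{\mathrm{ext}}$ is uniquely $t=w\tau$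 with $w\in W,\tau\in\Omega$, and $\bar t:=w$. Define $z_\gamma:=\overline{t_\gamma}^{ -1}\in W$.
   Formalization: The space V is ℚ^k rather than ℝ^k, so W, $W_{\mathrm{ext}}$ and Ω act on points with rational coordinates and the fundamental alcove $\mathcal{A}_\emptyset$ consists of rational points. -}

module Defs where

open import Data.Nat as ℕ using (ℕ; zero; suc; _<?_; _∸_)
open import Data.Nat.Properties using () renaming (_≟_ to _≟ℕ_)
open import Data.Fin using (Fin; toℕ)
open import Data.Integer as ℤ using (ℤ; +_)
open import Data.Rational using (ℚ; 0ℚ; 1ℚ; _+_; _-_; _*_; -_; _≤_; _/_)
open import Data.List using (List; []; _∷_; _++_; reverse; filter; allFin; concat; replicate)
open import Data.Bool using (if_then_else_)
open import Data.Product using (Σ; _×_)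
open import Relation.Nullary using (does)
open import Relation.Binary.PropositionalEquality using (_≡_)

-- Points of V = ℝ^k, represented by rational points.
-- Coordinate a_{i} (1-indexed in the paper) is  x p  with toℕ p = i - 1.

Pt : ℕ → Set
Pt k = Fin k → ℚ

2ℚ : ℚ
2ℚ = 1ℚ + 1ℚ

-- value of the coordinate with 0-based index n (0 if out of range; never
-- used out of range)
at : ∀ {k} → Pt k → ℕ → ℚ
at {k} x n = go k x n
  where
  go : ∀ m → Pt m → ℕ → ℚ
  go zero    x n       = 0ℚ
  go (suc m) x zero    = x Fin.zero
  go (suc m) x (suc n) = go m (λ p → x (Fin.suc p)) n

_==_ : ℕ → ℕ → Data.Bool.Bool
m == n = does (m ≟ℕ n)

-- The generators s_0, …, s_k of W (type C_k^{(1)}) acting on V.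
--  s_0 : a_1 ↦ 2 - a_1 ;  s_i (1 ≤ i ≤ k-1) swaps a_i, a_{i+1} ;  s_k : a_k ↦ -a_k.

actℕ : (k : ℕ) → ℕ → Pt k → Pt k
actℕ k zero x p = if toℕ p == 0 then 2ℚ - x p else x p
actℕ k (suc i) x p =
  if suc i == k
  then (if suc (toℕ p) == k then - x p else x p)
  else (if suc (toℕ p) == suc i then at x (suc i)
        else if toℕ p == suc i then at x i
        else x p)

act : ∀ {k} → Fin (suc k) → Pt k → Pt k
act {k} i = actℕ k (toℕ i)

-- Elements of W as words in the generators; the word  i₁ i₂ … iₙ  stands for
-- s_{i₁} s_{i₂} ⋯ s_{iₙ}, acting by (uv) ◇ x = u ◇ (v ◇ x).
Word : ℕ → Set
Word k = List (Fin (suc k))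

⟦_⟧ : ∀ {k} → Word k → Pt k → Pt k
⟦ [] ⟧    x = x
⟦ i ∷ w ⟧ x = act i (⟦ w ⟧ x)

-- inverse in W (each s_i is an involution)
inv : ∀ {k} → Word k → Word k
inv = reverse

pow : ∀ {k} → Word k → ℕ → Word k
pow w n = concat (replicate n w)

-- w_i = s_{i-1} ⋯ s_1 s_0   (for 1 ≤ i ≤ k+1)
wElt : (k : ℕ) → ℕ → Word k
wElt k i = reverse (filter (λ f → toℕ f <? i) (allFin (suc k)))

coweight : (k : ℕ) → ℕ → Pt k
coweight k i p = if does (toℕ p <? i) then (if i == k then 1ℚ else 2ℚ) else 0ℚ

transl : ∀ {k} → Pt k → Pt k → Pt k
transl γ x p = x p + γ p

scale : ∀ {k} → ℤ → Pt k → Pt k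
scale c γ p = (c / 1) * γ p

-- The extended affine Weyl group W_ext: generated by W and all t_γ, γ ∈ P^∨.
-- P^∨ is generated (as a group) by the Λ_i^∨, so W_ext is generated by the
-- s_i and the translations t_{c Λ_i^∨}, c ∈ ℤ.

data ExtLetter (k : ℕ) : Set where
  gen   : Fin (suc k) → ExtLetter k
  trans : ℤ → Fin k → ExtLetter k      -- trans c i = t_{c Λ^∨_{i+1}}

⟦_⟧L : ∀ {k} → ExtLetter k → Pt k → Pt k
⟦_⟧L {k} (gen i)     = act i
⟦_⟧L {k} (trans c i) = transl (scale c (coweight k (suc (toℕ i))))

ExtWord : ℕ → Set
ExtWord k = List (ExtLetter k)

⟦_⟧E : ∀ {k} → ExtWord k → Pt k → Pt k
⟦ [] ⟧E    x = x
⟦ l ∷ w ⟧E x = ⟦ l ⟧L (⟦ w ⟧E x)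

InA : ∀ {k} → Pt k → Set
InA {k} x =
  ((p : Fin k) → toℕ p ≡ 0 → x p ≤ 1ℚ) ×
  ((p q : Fin k) → toℕ q ≡ suc (toℕ p) → x q ≤ x p) ×
  ((p : Fin k) → suc (toℕ p) ≡ k → 0ℚ ≤ x p)

InΩ : ∀ {k} → ExtWord k → Set
InΩ {k} τ =
  ((x : Pt k) → InA x → InA (⟦ τ ⟧E x)) ×
  ((y : Pt k) → InA y → Σ (Pt k) λ x → InA x × ((p : Fin k) → ⟦ τ ⟧E x p ≡ y p))

-- t̄ = w : the W-component of the decomposition t = w τ, τ ∈ Ω
-- (equality of elements of W_ext is equality of their action on V).
IsBar : ∀ {k} → (Pt k → Pt k) → Word k → Set
IsBar {k} t w =
  Σ (ExtWord k) λ τ → InΩ τ × ((x : Pt k) (p : Fin k) → t x p ≡ ⟦ w ⟧ (⟦ τ ⟧E x) p)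

-- z_γ = u  :⇔  \overline{t_γ} = u⁻¹
ZEq : ∀ {k} → Pt k → Word k → Set
ZEq γ u = IsBar (transl γ) (inv u)

-- For j < k the coweight Λ_j^∨ lies in the coroot lattice, so t_γ ∈ W and its Ω-component is
-- trivial: it suffices that the j-th power of v⁻¹ = w_{k+1}⁻¹ w_k w_j⁻¹ acts as t_γ. Here
-- w_j⁻¹ = s_0 ⋯ s_{j-1} moves a_j to the front as 2 - a_j and shifts a_1, …, a_{j-1} one place
-- to the right, while w_{k+1}⁻¹ w_k = s_0 ⋯ s_{k-1} s_k s_{k-1} ⋯ s_0 is the reflection
-- a_1 ↦ 4 - a_1. Hence v⁻¹ rotates a_1, …, a_j cyclically, adding 2 to the coordinate that
-- wraps around, and j such rotations add 2 to each of a_1, …, a_j.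
module Submission where

open import Defs
open import Data.Nat using (ℕ; suc; _<_; _≤_; _∸_)
open import Data.List using (_++_)

open import Data.Bool using (true; false)
open import Data.Fin using (Fin; toℕ; fromℕ<)
open import Data.Fin.Properties using (toℕ-fromℕ<; toℕ<n)
open import Data.List
  using (List; []; _∷_; [_]; map; reverse; filter; allFin; tabulate; applyUpTo; upTo; downFrom)
open import Data.List.Properties
  using (map-++; map-tabulate; reverse-++; reverse-map; reverse-involutive; reverse-upTo;
         upTo-∷ʳ; ++-assoc; ++-identityʳ; filter-++; filter-all; filter-reject)
open import Data.List.Relation.Unary.All.Properties using (all-upTo)
open import Data.Nat using (zero; z≤n; s≤s; _+_; _<?_)
open import Data.Nat.Properties
  using (_≟_; n≤1+n; <⇒≢; >⇒≢; <⇒≤; ≤-refl; ≤⇒≯; ≮⇒≥; n<1+n; <-trans; <-≤-trans; ≤-pred; m≤m+n;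
         +-suc; +-comm; +-identityʳ; +-monoʳ-<; suc-injective; m≤n⇒m<n∨m≡n; m<1+n⇒m<n∨m≡n)
open import Data.Product using (_,_)
open import Data.Rational as ℚ using (ℚ; 0ℚ; -_; _-_)
import Data.Rational.Properties as ℚ
open import Data.Rational.Solver using (module +-*-Solver)
open import Data.Sum using (inj₁; inj₂)
open import Function using (_∘_)
open import Relation.Nullary using (yes; no; ¬_)
open import Relation.Nullary.Decidable using (does; dec-true; dec-false)
open import Relation.Unary using (Pred; Decidable)
open import Relation.Binary.PropositionalEquality as ≡
  using (_≡_; _≢_; refl; sym; cong; cong₂; subst; module ≡-Reasoning)

==-refl : ∀ n → (n == n) ≡ true
==-refl n = dec-true (n ≟ n) refl

==-≢ : ∀ {m n} → m ≢ n → (m == n) ≡ false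
==-≢ {m} {n} = dec-false (m ≟ n)

at-toℕ : ∀ {k} (x : Pt k) (p : Fin k) → at x (toℕ p) ≡ x p
at-toℕ {suc k} x Fin.zero    = refl
at-toℕ {suc k} x (Fin.suc p) = at-toℕ (λ q → x (Fin.suc q)) p

at-of : ∀ {k} (x : Pt k) {p : Fin k} {n} → toℕ p ≡ n → x p ≡ at x n
at-of x {p} p≡n = ≡.trans (sym (at-toℕ x p)) (cong (at x) p≡n)

at-intro : ∀ {k} (y : Pt k) {n c} → n < k → (∀ p → toℕ p ≡ n → y p ≡ c) → at y n ≡ c
at-intro y n<k y≡c =
  ≡.trans (cong (at y) (sym (toℕ-fromℕ< n<k))) (≡.trans (at-toℕ y _) (y≡c _ (toℕ-fromℕ< n<k)))

reflect : ℚ → ℚ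
reflect a = 2ℚ - a

module Generators {k : ℕ} (x : Pt k) where

  s₀-head : 0 < k → at (actℕ k 0 x) 0 ≡ reflect (at x 0)
  s₀-head 0<k = at-intro _ 0<k reflected
    where
    reflected : ∀ p → toℕ p ≡ 0 → actℕ k 0 x p ≡ reflect (at x 0)
    reflected p p≡0 rewrite p≡0 = cong reflect (at-of x p≡0)

  s₀-tail : ∀ {n} → n < k → n ≢ 0 → at (actℕ k 0 x) n ≡ at x n
  s₀-tail {n} n<k n≢0 = at-intro _ n<k fixed
    where
    fixed : ∀ p → toℕ p ≡ n → actℕ k 0 x p ≡ at x n
    fixed p p≡n rewrite p≡n | ==-≢ n≢0 = at-of x p≡n

  module _ {i : ℕ} (i+1<k : suc i < k) where

    sᵢ-left : at (actℕ k (suc i) x) i ≡ at x (suc i)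
    sᵢ-left = at-intro _ (<-trans (n<1+n i) i+1<k) swapped
      where
      swapped : ∀ p → toℕ p ≡ i → actℕ k (suc i) x p ≡ at x (suc i)
      swapped p p≡i rewrite p≡i | ==-≢ (<⇒≢ i+1<k) | ==-refl (suc i) = refl

    sᵢ-right : at (actℕ k (suc i) x) (suc i) ≡ at x i
    sᵢ-right = at-intro _ i+1<k swapped
      where
      swapped : ∀ p → toℕ p ≡ suc i → actℕ k (suc i) x p ≡ at x i
      swapped p p≡i+1 rewrite p≡i+1 | ==-≢ (<⇒≢ i+1<k)
        | ==-≢ {suc (suc i)} {suc i} (>⇒≢ (n<1+n (suc i))) | ==-refl (suc i) = refl

    sᵢ-other : ∀ {n} → n < k → n ≢ i → n ≢ suc i → at (actℕ k (suc i) x) n ≡ at x n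
    sᵢ-other {n} n<k n≢i n≢i+1 = at-intro _ n<k fixed
      where
      fixed : ∀ p → toℕ p ≡ n → actℕ k (suc i) x p ≡ at x n
      fixed p p≡n rewrite p≡n | ==-≢ (<⇒≢ i+1<k)
        | ==-≢ {suc n} (n≢i ∘ suc-injective) | ==-≢ n≢i+1 = at-of x p≡n

module LastGenerator {m : ℕ} (x : Pt (suc m)) where

  sₖ-last : at (actℕ (suc m) (suc m) x) m ≡ - at x m
  sₖ-last = at-intro _ (n<1+n m) negated
    where
    negated : ∀ p → toℕ p ≡ m → actℕ (suc m) (suc m) x p ≡ - at x m
    negated p p≡m rewrite p≡m | ==-refl (suc m) = cong -_ (at-of x p≡m)

  sₖ-other : ∀ {n} → n < m → at (actℕ (suc m) (suc m) x) n ≡ at x n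
  sₖ-other {n} n<m = at-intro _ (<-trans n<m (n<1+n m)) fixed
    where
    fixed : ∀ p → toℕ p ≡ n → actℕ (suc m) (suc m) x p ≡ at x n
    fixed p p≡n rewrite p≡n | ==-refl (suc m) | ==-≢ {suc n} (<⇒≢ (s≤s n<m)) = at-of x p≡n

open Generators
open LastGenerator

⟦_⟧ℕ : ∀ {k} → List ℕ → Pt k → Pt k
⟦ [] ⟧ℕ    x = x
⟦_⟧ℕ {k} (i ∷ w) x = actℕ k i (⟦ w ⟧ℕ x)

⟦⟧-toℕ : ∀ {k} (w : Word k) (x : Pt k) → ⟦ w ⟧ x ≡ ⟦ map toℕ w ⟧ℕ x
⟦⟧-toℕ []      x = refl
⟦⟧-toℕ (i ∷ w) x = cong (act i) (⟦⟧-toℕ w x)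

⟦⟧-++ : ∀ {k} (u w : Word k) (x : Pt k) → ⟦ u ++ w ⟧ x ≡ ⟦ u ⟧ (⟦ w ⟧ x)
⟦⟧-++ []      w x = refl
⟦⟧-++ (i ∷ u) w x = cong (act i) (⟦⟧-++ u w x)

⟦⟧ℕ-++ : ∀ {k} (u w : List ℕ) (x : Pt k) → ⟦ u ++ w ⟧ℕ x ≡ ⟦ u ⟧ℕ (⟦ w ⟧ℕ x)
⟦⟧ℕ-++     []      w x = refl
⟦⟧ℕ-++ {k} (i ∷ u) w x = cong (actℕ k i) (⟦⟧ℕ-++ u w x)

⟦upTo-suc⟧ℕ : ∀ {k} n (x : Pt k) → ⟦ upTo (suc n) ⟧ℕ x ≡ ⟦ upTo n ⟧ℕ (actℕ k n x)
⟦upTo-suc⟧ℕ n x = ≡.trans (cong (λ w → ⟦ w ⟧ℕ x) (sym (upTo-∷ʳ n))) (⟦⟧ℕ-++ (upTo n) [ n ] x)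

-- Coordinates are 0-based: position j holds the paper's a_{j+1}.
record RotatesRight {k} (c : ℚ → ℚ) (j : ℕ) (x y : Pt k) : Set where
  field
    head    : at y 0 ≡ c (at x j)
    shifted : ∀ {n} → n < j → at y (suc n) ≡ at x n
    beyond  : ∀ {n} → j < n → n < k → at y n ≡ at x n

record RotatesLeft {k} (c : ℚ → ℚ) (j : ℕ) (x y : Pt k) : Set where
  field
    shifted : ∀ {n} → n < j → at y n ≡ at x (suc n)
    last    : at y j ≡ c (at x 0)
    beyond  : ∀ {n} → j < n → n < k → at y n ≡ at x n

upTo-rotatesRight : ∀ {k} j → j < k → (x : Pt k) → RotatesRight reflect j x (⟦ upTo (suc j) ⟧ℕ x)
upTo-rotatesRight zero 0<k x = record
  { head    = s₀-head x 0<k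
  ; shifted = λ ()
  ; beyond  = λ 0<n n<k → s₀-tail x n<k (>⇒≢ 0<n)
  }
upTo-rotatesRight {k} (suc j) j+1<k x =
  subst (RotatesRight reflect (suc j) x) (sym (⟦upTo-suc⟧ℕ (suc j) x)) (record
    { head    = ≡.trans R.head (cong reflect (sᵢ-left x j+1<k))
    ; shifted = shifted
    ; beyond  = λ j+1<n n<k → ≡.trans (R.beyond (<-trans (n<1+n j) j+1<n) n<k)
                  (sᵢ-other x j+1<k n<k (>⇒≢ (<-trans (n<1+n j) j+1<n)) (>⇒≢ j+1<n))
    })
  where
  y = actℕ k (suc j) x
  module R = RotatesRight (upTo-rotatesRight j (<-trans (n<1+n j) j+1<k) y)
  shifted : ∀ {n} → n < suc j → at (⟦ upTo (suc j) ⟧ℕ y) (suc n) ≡ at x n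
  shifted n<j+1 with m<1+n⇒m<n∨m≡n n<j+1
  ... | inj₁ n<j  = ≡.trans (R.shifted n<j)
                      (sᵢ-other x j+1<k (<-trans n<j+1 j+1<k) (<⇒≢ n<j) (<⇒≢ n<j+1))
  ... | inj₂ refl = ≡.trans (R.beyond (n<1+n j) j+1<k) (sᵢ-right x j+1<k)

downFrom-rotatesLeft : ∀ {k} j → j < k → (x : Pt k) → RotatesLeft reflect j x (⟦ downFrom (suc j) ⟧ℕ x)
downFrom-rotatesLeft zero 0<k x = record
  { shifted = λ ()
  ; last    = s₀-head x 0<k
  ; beyond  = λ 0<n n<k → s₀-tail x n<k (>⇒≢ 0<n)
  }
downFrom-rotatesLeft {k} (suc j) j+1<k x = record
  { shifted = shifted
  ; last    = ≡.trans (sᵢ-right y j+1<k) L.last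
  ; beyond  = λ j+1<n n<k →
      ≡.trans (sᵢ-other y j+1<k n<k (>⇒≢ (<-trans (n<1+n j) j+1<n)) (>⇒≢ j+1<n))
            (L.beyond (<-trans (n<1+n j) j+1<n) n<k)
  }
  where
  y = ⟦ downFrom (suc j) ⟧ℕ x
  module L = RotatesLeft (downFrom-rotatesLeft j (<-trans (n<1+n j) j+1<k) x)
  shifted : ∀ {n} → n < suc j → at (actℕ k (suc j) y) n ≡ at x (suc n)
  shifted n<j+1 with m<1+n⇒m<n∨m≡n n<j+1
  ... | inj₁ n<j  = ≡.trans (sᵢ-other y j+1<k (<-trans n<j+1 j+1<k) (<⇒≢ n<j) (<⇒≢ n<j+1))
                      (L.shifted n<j)
  ... | inj₂ refl = ≡.trans (sᵢ-left y j+1<k) (L.beyond (n<1+n j) j+1<k)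

first-reflection : ∀ m (y : Pt (suc m)) →
  RotatesRight (λ a → reflect (- reflect a)) 0 y (⟦ upTo (suc (suc m)) ⟧ℕ (⟦ downFrom (suc m) ⟧ℕ y))
first-reflection m y =
  subst (RotatesRight _ 0 y) (sym (⟦upTo-suc⟧ℕ (suc m) z)) (record
    { head    = ≡.trans R.head (cong reflect (≡.trans (sₖ-last z) (cong -_ L.last)))
    ; shifted = λ ()
    ; beyond  = beyond
    })
  where
  z = ⟦ downFrom (suc m) ⟧ℕ y
  module L = RotatesLeft (downFrom-rotatesLeft m (n<1+n m) y)
  module R = RotatesRight (upTo-rotatesRight m (n<1+n m) (actℕ (suc m) (suc m) z))
  beyond : ∀ {n} → 0 < n → n < suc m → at (⟦ upTo (suc m) ⟧ℕ (actℕ (suc m) (suc m) z)) n ≡ at y n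
  beyond {suc n} _ n+1<m+1 = ≡.trans (R.shifted (≤-pred n+1<m+1))
                               (≡.trans (sₖ-other z (≤-pred n+1<m+1)) (L.shifted (≤-pred n+1<m+1)))

rotatesRight-∘ : ∀ {k} {c d : ℚ → ℚ} {j} {x y z : Pt k} → j < k →
  RotatesRight c j x y → RotatesRight d 0 y z → RotatesRight (d ∘ c) j x z
rotatesRight-∘ {d = d} j<k x↦y y↦z = record
  { head    = ≡.trans Z.head (cong d Y.head)
  ; shifted = λ n<j → ≡.trans (Z.beyond (s≤s z≤n) (<-≤-trans (s≤s n<j) j<k)) (Y.shifted n<j)
  ; beyond  = λ j<n n<k → ≡.trans (Z.beyond (<-≤-trans (s≤s z≤n) j<n) n<k) (Y.beyond j<n n<k)
  }
  where
  module Y = RotatesRight x↦y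
  module Z = RotatesRight y↦z

map-filter : ∀ {a b p} {A : Set a} {B : Set b} {P : Pred B p} (f : A → B) (P? : Decidable P) xs →
  map f (filter (P? ∘ f) xs) ≡ filter P? (map f xs)
map-filter f P? []       = refl
map-filter f P? (x ∷ xs) with does (P? (f x))
... | true  = cong (f x ∷_) (map-filter f P? xs)
... | false = map-filter f P? xs

tabulate-∘toℕ : ∀ {a} {A : Set a} n (f : ℕ → A) → tabulate {n = n} (f ∘ toℕ) ≡ applyUpTo f n
tabulate-∘toℕ zero    f = refl
tabulate-∘toℕ (suc n) f = cong (f 0 ∷_) (tabulate-∘toℕ n (f ∘ suc))

map-toℕ-allFin : ∀ n → map toℕ (allFin n) ≡ upTo n
map-toℕ-allFin n = ≡.trans (map-tabulate (λ i → i) toℕ) (tabulate-∘toℕ n (λ i → i))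

filter-<-upTo : ∀ {i n} → i ≤ n → filter (_<? i) (upTo n) ≡ upTo i
filter-<-upTo {n = zero} z≤n = refl
filter-<-upTo {i} {suc n} i≤n+1 with m≤n⇒m<n∨m≡n i≤n+1
... | inj₂ refl = filter-all (_<? i) (all-upTo i)
... | inj₁ i<n+1 = begin
  filter (_<? i) (upTo (suc n))                    ≡⟨ cong (filter (_<? i)) (sym (upTo-∷ʳ n)) ⟩
  filter (_<? i) (upTo n ++ [ n ])                 ≡⟨ filter-++ (_<? i) (upTo n) [ n ] ⟩
  filter (_<? i) (upTo n) ++ filter (_<? i) [ n ]  ≡⟨ cong₂ _++_ (filter-<-upTo (≤-pred i<n+1))
                                                        (filter-reject (_<? i) (≤⇒≯ (≤-pred i<n+1))) ⟩
  upTo i ++ []                                     ≡⟨ ++-identityʳ (upTo i) ⟩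
  upTo i                                           ∎
  where open ≡-Reasoning

map-toℕ-inv-wElt : ∀ {k i} → i ≤ suc k → map toℕ (inv (wElt k i)) ≡ upTo i
map-toℕ-inv-wElt {k} {i} i≤k+1 = begin
  map toℕ (reverse (reverse (filter ((_<? i) ∘ toℕ) (allFin (suc k)))))
    ≡⟨ cong (map toℕ) (reverse-involutive _) ⟩
  map toℕ (filter ((_<? i) ∘ toℕ) (allFin (suc k)))
    ≡⟨ map-filter toℕ (_<? i) (allFin (suc k)) ⟩
  filter (_<? i) (map toℕ (allFin (suc k)))
    ≡⟨ cong (filter (_<? i)) (map-toℕ-allFin (suc k)) ⟩
  filter (_<? i) (upTo (suc k))
    ≡⟨ filter-<-upTo i≤k+1 ⟩
  upTo i ∎
  where open ≡-Reasoning

map-toℕ-wElt : ∀ {k i} → i ≤ suc k → map toℕ (wElt k i) ≡ downFrom i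
map-toℕ-wElt {k} {i} i≤k+1 = begin
  map toℕ (wElt k i)                 ≡⟨ cong (map toℕ) (sym (reverse-involutive (wElt k i))) ⟩
  map toℕ (reverse (inv (wElt k i))) ≡⟨ reverse-map toℕ (inv (wElt k i)) ⟩
  reverse (map toℕ (inv (wElt k i))) ≡⟨ cong reverse (map-toℕ-inv-wElt i≤k+1) ⟩
  reverse (upTo i)                   ≡⟨ reverse-upTo i ⟩
  downFrom i                         ∎
  where open ≡-Reasoning

zFactor : (k j : ℕ) → Word k
zFactor k j = wElt k j ++ inv (wElt k k) ++ wElt k (suc k)

inv-++ : ∀ {k} (u w : Word k) → inv (u ++ w) ≡ inv w ++ inv u
inv-++ = reverse-++

map-toℕ-inv-zFactor : ∀ {k j} → j ≤ suc k →
  map toℕ (inv (zFactor k j)) ≡ upTo (suc k) ++ downFrom k ++ upTo j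
map-toℕ-inv-zFactor {k} {j} j≤k+1 = begin
  map toℕ (inv (A ++ B ++ C))
    ≡⟨ cong (map toℕ) (≡.trans (inv-++ A (B ++ C)) (≡.trans (cong (_++ inv A) (inv-++ B C))
                                                        (++-assoc (inv C) (inv B) (inv A)))) ⟩
  map toℕ (inv C ++ inv B ++ inv A)
    ≡⟨ ≡.trans (map-++ toℕ (inv C) _) (cong (map toℕ (inv C) ++_) (map-++ toℕ (inv B) (inv A))) ⟩
  map toℕ (inv C) ++ map toℕ (inv B) ++ map toℕ (inv A)
    ≡⟨ cong₂ _++_ (map-toℕ-inv-wElt {k} ≤-refl)
         (cong₂ _++_ (≡.trans (cong (map toℕ) (reverse-involutive (wElt k k))) (map-toℕ-wElt (n≤1+n k)))
                     (map-toℕ-inv-wElt j≤k+1)) ⟩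
  upTo (suc k) ++ downFrom k ++ upTo j ∎
  where
  open ≡-Reasoning
  A = wElt k j
  B = inv (wElt k k)
  C = wElt k (suc k)

⟦inv-zFactor⟧ : ∀ {k j} → j ≤ suc k → (x : Pt k) →
  ⟦ inv (zFactor k j) ⟧ x ≡ ⟦ upTo (suc k) ⟧ℕ (⟦ downFrom k ⟧ℕ (⟦ upTo j ⟧ℕ x))
⟦inv-zFactor⟧ {k} {j} j≤k+1 x = begin
  ⟦ inv (zFactor k j) ⟧ x                         ≡⟨ ⟦⟧-toℕ (inv (zFactor k j)) x ⟩
  ⟦ map toℕ (inv (zFactor k j)) ⟧ℕ x              ≡⟨ cong (λ w → ⟦ w ⟧ℕ x) (map-toℕ-inv-zFactor j≤k+1) ⟩
  ⟦ upTo (suc k) ++ downFrom k ++ upTo j ⟧ℕ x     ≡⟨ ⟦⟧ℕ-++ (upTo (suc k)) (downFrom k ++ upTo j) x ⟩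
  ⟦ upTo (suc k) ⟧ℕ (⟦ downFrom k ++ upTo j ⟧ℕ x) ≡⟨ cong ⟦ upTo (suc k) ⟧ℕ (⟦⟧ℕ-++ (downFrom k) (upTo j) x) ⟩
  ⟦ upTo (suc k) ⟧ℕ (⟦ downFrom k ⟧ℕ (⟦ upTo j ⟧ℕ x)) ∎
  where open ≡-Reasoning

inv-zFactor-rotatesRight : ∀ {m j} → j < m → (x : Pt (suc m)) →
  RotatesRight (λ a → reflect (- reflect (reflect a))) j x (⟦ inv (zFactor (suc m) (suc j)) ⟧ x)
inv-zFactor-rotatesRight {m} {j} j<m x =
  subst (RotatesRight _ j x) (sym (⟦inv-zFactor⟧ (s≤s (<⇒≤ j<m+1)) x))
    (rotatesRight-∘ j<m+1 (upTo-rotatesRight j j<m+1 x) (first-reflection m _))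
  where
  j<m+1 : j < suc m
  j<m+1 = <-trans j<m (n<1+n m)

⟦inv-pow-suc⟧ : ∀ {k} (u : Word k) i (x : Pt k) →
  ⟦ inv (pow u (suc i)) ⟧ x ≡ ⟦ inv (pow u i) ⟧ (⟦ inv u ⟧ x)
⟦inv-pow-suc⟧ u i x = ≡.trans (cong (λ w → ⟦ w ⟧ x) (inv-++ u (pow u i))) (⟦⟧-++ (inv (pow u i)) (inv u) x)

-- After i of the i + d = j + 1 rotations of positions 0, …, j, the coordinates x_d, …, x_j
-- have wrapped around once (acquiring c) and x_0, …, x_{d-1} sit at positions i, …, j.
record PartlyRotated {k} (c : ℚ → ℚ) (j i d : ℕ) (x y : Pt k) : Set where
  field
    wrapped : ∀ {n} → n < i → at y n ≡ c (at x (d + n))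
    pending : ∀ {e} → e < d → at y (i + e) ≡ at x e
    beyond  : ∀ {n} → j < n → n < k → at y n ≡ at x n

pow-partlyRotated : ∀ {k} (u : Word k) {c j} → (∀ x → RotatesRight c j x (⟦ inv u ⟧ x)) →
  ∀ i d → i + d ≡ suc j → (x : Pt k) → PartlyRotated c j i d x (⟦ inv (pow u i) ⟧ x)
pow-partlyRotated u rotates zero d _ x = record
  { wrapped = λ ()
  ; pending = λ _ → refl
  ; beyond  = λ _ _ → refl
  }
pow-partlyRotated u {c} {j} rotates (suc i) d i+1+d≡j+1 x =
  subst (PartlyRotated c j (suc i) d x) (sym (⟦inv-pow-suc⟧ u i x)) (record
    { wrapped = wrapped
    ; pending = λ {e} e<d → ≡.trans (subst (λ n → at y n ≡ at (⟦ inv u ⟧ x) (suc e)) (+-suc i e) (IH.pending (s≤s e<d)))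
                              (R.shifted (<-≤-trans e<d (subst (d ≤_) d+i≡j (m≤m+n d i))))
    ; beyond  = λ j<n n<k → ≡.trans (IH.beyond j<n n<k) (R.beyond j<n n<k)
    })
  where
  y = ⟦ inv (pow u i) ⟧ (⟦ inv u ⟧ x)
  d+i≡j : d + i ≡ j
  d+i≡j = suc-injective (≡.trans (cong suc (+-comm d i)) i+1+d≡j+1)
  module R  = RotatesRight (rotates x)
  module IH = PartlyRotated (pow-partlyRotated u rotates i (suc d)
                (≡.trans (+-suc i d) i+1+d≡j+1) (⟦ inv u ⟧ x))
  wrapped : ∀ {n} → n < suc i → at y n ≡ c (at x (d + n))
  wrapped n<i+1 with m<1+n⇒m<n∨m≡n n<i+1
  ... | inj₁ n<i  = ≡.trans (IH.wrapped n<i)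
                      (cong c (R.shifted (subst (_ <_) d+i≡j (+-monoʳ-< d n<i))))
  ... | inj₂ refl = ≡.trans (subst (λ n → at y n ≡ at (⟦ inv u ⟧ x) 0) (+-identityʳ i) (IH.pending (s≤s z≤n)))
                      (≡.trans R.head (cong (c ∘ at x) (sym d+i≡j)))

reflect-neg-reflect² : ∀ a → reflect (- reflect (reflect a)) ≡ a ℚ.+ 2ℚ
reflect-neg-reflect² = solve 1 (λ a → con 2ℚ :- :- (con 2ℚ :- (con 2ℚ :- a)) := a :+ con 2ℚ) refl
  where open +-*-Solver

coweight-< : ∀ {k j} (p : Fin k) → toℕ p < j → j ≢ k → coweight k j p ≡ 2ℚ
coweight-< {k} {j} p p<j j≢k rewrite dec-true (toℕ p <? j) p<j | ==-≢ j≢k = refl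

coweight-≮ : ∀ {k j} (p : Fin k) → ¬ toℕ p < j → coweight k j p ≡ 0ℚ
coweight-≮ {k} {j} p p≮j rewrite dec-false (toℕ p <? j) p≮j = refl

[]∈Ω : ∀ {k} → InΩ {k} []
[]∈Ω = (λ x x∈A → x∈A) , (λ y y∈A → y , y∈A , λ p → refl)

lemma3p9 : (k : ℕ) → 1 < k → (j : ℕ) → 1 ≤ j → j ≤ k ∸ 1 →
    ZEq (coweight k j) (pow (wElt k j ++ inv (wElt k k) ++ wElt k (suc k)) j)
lemma3p9 (suc m) _ zero    () _
lemma3p9 (suc m) _ (suc j) _  j<m = [] , []∈Ω , translates
  where
  v = zFactor (suc m) (suc j)
  rotated : (x : Pt (suc m)) → PartlyRotated _ j (suc j) 0 x (⟦ inv (pow v (suc j)) ⟧ x)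
  rotated = pow-partlyRotated v (inv-zFactor-rotatesRight j<m) (suc j) 0 (+-identityʳ (suc j))
  translates : ∀ x p → x p ℚ.+ coweight (suc m) (suc j) p ≡ ⟦ inv (pow v (suc j)) ⟧ x p
  translates x p with toℕ p <? suc j
  ... | yes p<j+1 = begin
    x p ℚ.+ coweight (suc m) (suc j) p           ≡⟨ cong (x p ℚ.+_) (coweight-< p p<j+1 (<⇒≢ (s≤s j<m))) ⟩
    x p ℚ.+ 2ℚ                                   ≡⟨ sym (reflect-neg-reflect² (x p)) ⟩
    reflect (- reflect (reflect (x p)))          ≡⟨ cong (λ a → reflect (- reflect (reflect a))) (at-of x refl) ⟩
    reflect (- reflect (reflect (at x (toℕ p)))) ≡⟨ sym (PartlyRotated.wrapped (rotated x) p<j+1) ⟩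
    at (⟦ inv (pow v (suc j)) ⟧ x) (toℕ p)       ≡⟨ at-toℕ _ p ⟩
    ⟦ inv (pow v (suc j)) ⟧ x p                  ∎
    where open ≡-Reasoning
  ... | no p≮j+1 = begin
    x p ℚ.+ coweight (suc m) (suc j) p     ≡⟨ cong (x p ℚ.+_) (coweight-≮ p p≮j+1) ⟩
    x p ℚ.+ 0ℚ                             ≡⟨ ℚ.+-identityʳ (x p) ⟩
    x p                                    ≡⟨ at-of x refl ⟩
    at x (toℕ p)                           ≡⟨ sym (PartlyRotated.beyond (rotated x) (≮⇒≥ p≮j+1) (toℕ<n p)) ⟩
    at (⟦ inv (pow v (suc j)) ⟧ x) (toℕ p) ≡⟨ at-toℕ _ p ⟩
    ⟦ inv (pow v (suc j)) ⟧ x p            ∎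
    where open ≡-Reasoning
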